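{- Let $p\geq 7$ be a prime and let $(a_3,a_4)\in\{(\frac14,-\frac18),(\frac34,\frac38)\}$ modulo $p$. Then: (1) if $p=7$, the number of different minors of $A_5(1,1,a_3,a_4,a_5)$ involving $a_5$ (that is, $|S_5(a_3,a_4)|$) is $6$; (2) if $p>7$, this number is $7$; (3) for $p\geq 7$, the matrix $A_5(1,1,a_3,a_4,\frac14)$ is LT-superregular; (4) if $p\geq 11$, the matrix $A_5(1,1,\frac12,1,-\frac12)$ is LT-superregular.
   Context: Let $p$ be an odd prime and $\mathbb{F}_p$ the field with $p$ elements; fractions such as $\frac14$ denote the corresponding elements of $\mathbb{F}_p$ (inverses modulo $p$). For $\gamma\geq 3$ and $a_3,\dots,a_\gamma\in\mathbb{F}_p$, $A_\gamma(1,1,a_3,\dots,a_\gamma)$ denotes the $\gamma\times\gamma$ lower triangular Toeplitz matrix whose $(i,j)$ entry is $a_{i-j+1}$ if $i\geq j$ and $0$ if $i<j$, where $a_1=a_2=1$. A lower triangular matrix $B$ is LT-superregular if every square submatrix of $B$ with rows $i_1<\dots<i_k$ and columns $j_1<\dots<j_k$ satisfying $i_t\geq j_t$ for all $t$ has nonzero determinant. Given $a_3,\dots,a_{\gamma-1}$, replace $a_\gamma$ by an indeterminate $x$. A square submatrix $M$ of $A_\gamma(1,1,a_3,\dots,a_{\gamma-1},x)$ involves $a_\gamma$ if the Leibniz expansion of $\det M$ contains a term in which the entry $x$ (position $(\gamma,1)$) is a factor and all other factors are entries from positions $(i,j)$ with $i\geq j$; then $\det M$ is a polynomial in $x$ of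 degree at most $1$. Define $S_\gamma=S_\gamma(a_3,\dots,a_{\gamma-1})$ to be the set of $c\in\mathbb{F}_p$ such that $\det M$ vanishes at $x=c$ for at least one submatrix $M$ involving $a_\gamma$. The number of different minors of $A_\gamma$ involving $a_\gamma$ means $|S_\gamma|$. -}

module Defs where

open import Data.Nat as ℕ using (ℕ; zero; suc; _≤?_)
open import Data.Integer as ℤ using (ℤ; +_; -_; _*_; _+_)
open import Data.Integer.Divisibility using (_∣_)
open import Data.Fin as Fin using (Fin; toℕ; fromℕ; punchIn)
open import Data.Fin.Permutation using (Permutation′; _⟨$⟩ʳ_)
open import Data.List using (List; []; _∷_; length)
open import Data.List.Membership.Propositional using (_∈_)
open import Data.List.Relation.Unary.Unique.Propositional using (Unique)
open import Data.Product using (Σ; ∃; _×_; Σ-syntax; ∃-syntax)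
open import Relation.Binary.PropositionalEquality using (_≡_)
open import Relation.Nullary using (¬_; yes; no)
open import Function.Bundles using (_⇔_)

-- Elements of F_p are represented by integers; an integer z is zero in F_p
-- iff p ∣ z.  Canonical representatives of F_p are Fin p (via toℕ).

Mat : ℕ → Set
Mat n = Fin n → Fin n → ℤ

∑ : (k : ℕ) → (Fin k → ℤ) → ℤ
∑ zero    f = + 0
∑ (suc k) f = f Fin.zero + ∑ k (λ i → f (Fin.suc i))

sgn : ℕ → ℤ
sgn zero          = + 1
sgn (suc zero)    = - (+ 1)
sgn (suc (suc n)) = sgn n

det : (k : ℕ) → Mat k → ℤ
det zero    M = + 1
det (suc k) M = ∑ (suc k) (λ j → sgn (toℕ j) * (M Fin.zero j * det k (λ r c → M (Fin.suc r) (punchIn j c))))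

-- lower triangular Toeplitz matrix with (0-based) (i,j) entry a (i - j) for i ≥ j, else 0
-- (so, 1-based, entry (i,j) is a_{i-j+1}, with a 0 = a_1, a 1 = a_2, ...)
Toeplitz : (n : ℕ) → (ℕ → ℤ) → Mat n
Toeplitz n a i j with toℕ j ≤? toℕ i
... | yes _ = a (toℕ i ℕ.∸ toℕ j)
... | no  _ = + 0

seqOf : List ℤ → ℕ → ℤ
seqOf []       _       = + 0
seqOf (x ∷ xs) zero    = x
seqOf (x ∷ xs) (suc n) = seqOf xs n

A : (γ : ℕ) → List ℤ → Mat γ
A γ as = Toeplitz γ (seqOf as)

StrictlyIncreasing : {k n : ℕ} → (Fin k → Fin n) → Set
StrictlyIncreasing f = ∀ s t → s Fin.< t → f s Fin.< f t

sub : {n k : ℕ} → Mat n → (Fin k → Fin n) → (Fin k → Fin n) → Mat k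
sub M r c s t = M (r s) (c t)

LTSuperregular : (p n : ℕ) → Mat n → Set
LTSuperregular p n M =
  ∀ (k : ℕ) (r c : Fin k → Fin n) → StrictlyIncreasing r → StrictlyIncreasing c →
  (∀ t → c t Fin.≤ r t) → ¬ ((+ p) ∣ det k (sub M r c))

-- The submatrix with rows r and columns c of A_γ involves a_γ (position (γ,1),
-- i.e. 0-based (γ-1, 0)): some Leibniz term (permutation σ, factors M_{t,σ t})
-- has the entry (γ,1) as a factor and all factors in positions (i,j) with i ≥ j.
Involves : (γ k : ℕ) → (Fin k → Fin γ) → (Fin k → Fin γ) → Set
Involves γ k r c =
  Σ[ σ ∈ Permutation′ k ]
    ((∀ t → c (σ ⟨$⟩ʳ t) Fin.≤ r t) ×
     (∃[ t ] (toℕ (r t) ≡ γ ℕ.∸ 1 × toℕ (c (σ ⟨$⟩ʳ t)) ≡ 0)))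

-- c ∈ S_γ(a_3,...,a_{γ-1}) (c ∈ F_p given by its representative in Fin p):
-- some submatrix involving a_γ has determinant vanishing at x = c.
InS : (p γ : ℕ) → List ℤ → Fin p → Set
InS p γ as x =
  ∃[ k ] Σ[ r ∈ (Fin k → Fin γ) ] Σ[ c ∈ (Fin k → Fin γ) ]
    (StrictlyIncreasing r × StrictlyIncreasing c × Involves γ k r c ×
     (+ p) ∣ det k (sub (A γ (+ 1 ∷ + 1 ∷ appendLast as (+ toℕ x))) r c))
  where
  appendLast : List ℤ → ℤ → List ℤ
  appendLast []       y = y ∷ []
  appendLast (z ∷ zs) y = z ∷ appendLast zs y

HasSize : {p : ℕ} → ℕ → (Fin p → Set) → Set
HasSize {p} m P = Σ[ xs ∈ List (Fin p) ] (length xs ≡ m × Unique xs × (∀ x → (x ∈ xs) ⇔ P x))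

{-# OPTIONS --safe #-}

-- Multiplying by 8, a unit modulo p ≥ 7, turns A₅(1, 1, a₃, a₄, x) into an integer Toeplitz matrix
-- whose minors vanish modulo p exactly when those of A₅ do.  For (3) and (4) every lower triangular
-- minor of that integer matrix is evaluated: its prime factors are among 2, 3, 5 (and 7 in (4)), so it
-- is nonzero modulo p.  For (1) and (2), x occupies a single entry, so a minor involving a₅ is an
-- affine form α + x β.  Evaluation shows that β has prime factors among 2, 3, 5 and that (α, β) is
-- proportional to one of seven forms, each realised by an explicit minor.  Hence S₅ is the set of
-- roots of these seven forms.  Their pairwise resultants have prime factors at most 7: the seven roots
-- are distinct for p > 7, and for p = 7 exactly two of them coincide.

module Submission where

open import Data.Bool using (Bool; true; T; T?; _∧_)
open import Data.Bool.ListAction using (all; any)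
open import Data.Bool.Properties using (T-∧)
open import Data.Empty using (⊥-elim)
open import Data.Fin as Fin using (Fin; toℕ; fromℕ<; punchIn; #_)
open import Data.Fin.Permutation as Perm using (Permutation′; _⟨$⟩ʳ_; _⟨$⟩ˡ_; inverseˡ)
import Data.Fin.Properties as Finₚ
open import Data.Integer as ℤ using (ℤ; +_; -_; -[1+_]; _*_; _+_; _-_; _^_)
import Data.Integer.DivMod as ℤ
open import Data.Integer.Divisibility using (_∣_)
open import Data.Integer.Divisibility.Signed as Signed using () renaming (_∣_ to _∣ₛ_)
import Data.Integer.Properties as ℤₚ
open import Data.Integer.Tactic.RingSolver using (solve-∀)
open import Data.List as List using (List; []; _∷_; length; allFin; upTo; cartesianProductWith; filterᵇ)
open import Data.List.Membership.Propositional using (_∈_; lose)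
import Data.List.Membership.Propositional.Properties as ∈ₚ
import Data.List.Properties as Listₚ
open import Data.List.Relation.Binary.Pointwise using (Pointwise; []; _∷_)
open import Data.List.Relation.Unary.All as All using (All; []; _∷_)
open import Data.List.Relation.Unary.All.Properties using (all⁺; all⁻)
open import Data.List.Relation.Unary.AllPairs as AllPairs using (AllPairs; []; _∷_)
open import Data.List.Relation.Unary.Any as Any using (Any; here; there)
open import Data.List.Relation.Unary.Any.Properties as Anyₚ using (any⁺; any⁻)
open import Data.List.Relation.Unary.Unique.Propositional using (Unique)
open import Data.Nat as ℕ using (ℕ; zero; suc; _≤_; _<_)
open import Data.Nat.Coprimality using (Coprime; coprime-Bézout)
import Data.Nat.Divisibility as ℕ
open import Data.Nat.GCD using (module Bézout)
open import Data.Nat.Primality using (Prime; euclidsLemma; prime⇒irreducible; prime⇒nonZero)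
import Data.Nat.Properties as ℕₚ
open import Data.Product using (Σ-syntax; ∃; _×_; _,_; proj₁; proj₂)
open import Data.Sum using (_⊎_; inj₁; inj₂)
open import Data.Vec as Vec using (Vec; []; _∷_; lookup; tabulate)
import Data.Vec.Properties as Vecₚ
open import Function using (_∘_)
open import Function.Bundles using (_⇔_; mk⇔; Equivalence)
import Function.Properties.Equivalence as ⇔
open import Relation.Binary using (tri<; tri≈; tri>)
open import Relation.Binary.PropositionalEquality
open import Relation.Nullary using (¬_; yes; no)
open import Relation.Nullary.Decidable
  using (True; ⌊_⌋; _×-dec_; _⊎-dec_; _→-dec_; from-yes; toWitness; fromWitness)

open import Defs

minor : ∀ {n k} → Mat n → (Fin k → Fin n) → (Fin k → Fin n) → ℤ
minor {k = k} M r c = det k (sub M r c)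

∑-cong : ∀ k {f g : Fin k → ℤ} → (∀ i → f i ≡ g i) → ∑ k f ≡ ∑ k g
∑-cong zero    f≗g = refl
∑-cong (suc k) f≗g = cong₂ _+_ (f≗g Fin.zero) (∑-cong k (f≗g ∘ Fin.suc))

det-cong : ∀ k {M N : Mat k} → (∀ i j → M i j ≡ N i j) → det k M ≡ det k N
det-cong zero    M≗N = refl
det-cong (suc k) M≗N = ∑-cong (suc k) λ j →
  cong₂ (λ a b → sgn (toℕ j) * (a * b)) (M≗N Fin.zero j)
        (det-cong k λ r c → M≗N (Fin.suc r) (punchIn j c))

minor-tabulate : ∀ {n k} (M : Mat n) (r c : Fin k → Fin n) →
                 minor M (lookup (tabulate r)) (lookup (tabulate c)) ≡ minor M r c
minor-tabulate {k = k} M r c = det-cong k λ i j → cong₂ M (Vecₚ.lookup∘tabulate r i) (Vecₚ.lookup∘tabulate c j)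

∑-*-distribˡ : ∀ k c (f : Fin k → ℤ) → ∑ k (λ i → c * f i) ≡ c * ∑ k f
∑-*-distribˡ zero    c f = sym (ℤₚ.*-zeroʳ c)
∑-*-distribˡ (suc k) c f = trans (cong (λ z → c * f Fin.zero + z) (∑-*-distribˡ k c (λ i → f (Fin.suc i))))
                                 (sym (ℤₚ.*-distribˡ-+ c _ _))

det-*-scale : ∀ k s (M : Mat k) → det k (λ i j → s * M i j) ≡ s ^ k * det k M
det-*-scale zero    s M = refl
det-*-scale (suc k) s M = trans (∑-cong (suc k) term) (∑-*-distribˡ (suc k) (s ^ suc k) expansion)
  where
  cofactor : Fin (suc k) → ℤ
  cofactor j = det k (λ r c → M (Fin.suc r) (punchIn j c))
  expansion : Fin (suc k) → ℤ
  expansion j = sgn (toℕ j) * (M Fin.zero j * cofactor j)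
  regroup : ∀ g s m q d → g * ((s * m) * (q * d)) ≡ (s * q) * (g * (m * d))
  regroup = solve-∀
  term : ∀ j → sgn (toℕ j) * ((s * M Fin.zero j) * det k (λ r c → s * M (Fin.suc r) (punchIn j c)))
             ≡ s ^ suc k * expansion j
  term j = trans (cong (λ d → sgn (toℕ j) * ((s * M Fin.zero j) * d))
                       (det-*-scale k s (λ r c → M (Fin.suc r) (punchIn j c))))
                 (regroup (sgn (toℕ j)) s (M Fin.zero j) (s ^ k) (cofactor j))

∣ₛ0 : ∀ p → + p ∣ₛ + 0
∣ₛ0 p = Signed.divides (+ 0) refl

∑-cong-mod : ∀ p k (f g : Fin k → ℤ) → (∀ i → + p ∣ₛ f i - g i) → + p ∣ₛ ∑ k f - ∑ k g
∑-cong-mod p zero    f g f≡g = ∣ₛ0 p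
∑-cong-mod p (suc k) f g f≡g = subst (+ p ∣ₛ_) (regroup (f Fin.zero) (g Fin.zero) _ _)
  (Signed.∣m∣n⇒∣m+n (f≡g Fin.zero) (∑-cong-mod p k (f ∘ Fin.suc) (g ∘ Fin.suc) (f≡g ∘ Fin.suc)))
  where
  regroup : ∀ a b x y → (a - b) + (x - y) ≡ (a + x) - (b + y)
  regroup = solve-∀

det-cong-mod : ∀ p k (M N : Mat k) → (∀ i j → + p ∣ₛ M i j - N i j) → + p ∣ₛ det k M - det k N
det-cong-mod p zero    M N M≡N = ∣ₛ0 p
det-cong-mod p (suc k) M N M≡N = ∑-cong-mod p (suc k) (expansion M) (expansion N) λ j →
  subst (+ p ∣ₛ_) (expand (sgn (toℕ j)) (M Fin.zero j) (N Fin.zero j) _ _)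
    (Signed.∣n⇒∣m*n (sgn (toℕ j)) (Signed.∣m∣n⇒∣m+n
      (Signed.∣m⇒∣m*n _ (M≡N Fin.zero j))
      (Signed.∣n⇒∣m*n (N Fin.zero j)
        (det-cong-mod p k (cofactor M j) (cofactor N j) λ r c → M≡N (Fin.suc r) (punchIn j c)))))
  where
  cofactor : Mat (suc k) → Fin (suc k) → Mat k
  cofactor M j r c = M (Fin.suc r) (punchIn j c)
  expansion : Mat (suc k) → Fin (suc k) → ℤ
  expansion M j = sgn (toℕ j) * (M Fin.zero j * det k (cofactor M j))
  expand : ∀ s a b x y → s * ((a - b) * x + b * (x - y)) ≡ s * (a * x) - s * (b * y)
  expand = solve-∀

prime∤1ℕ : ∀ {p} → Prime p → ¬ p ℕ.∣ 1
prime∤1ℕ pr p∣1 with ℕ.∣1⇒≡1 p∣1 | pr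
... | refl | ()

prime∤* : ∀ {p} → Prime p → ∀ {m n} → ¬ p ℕ.∣ m → ¬ p ℕ.∣ n → ¬ p ℕ.∣ m ℕ.* n
prime∤* pr {m} {n} p∤m p∤n p∣mn with euclidsLemma m n pr p∣mn
... | inj₁ p∣m = p∤m p∣m
... | inj₂ p∣n = p∤n p∣n

prime∤^ℕ : ∀ {p} → Prime p → ∀ {m} k → ¬ p ℕ.∣ m → ¬ p ℕ.∣ m ℕ.^ k
prime∤^ℕ pr zero    p∤m = prime∤1ℕ pr
prime∤^ℕ pr (suc k) p∤m = prime∤* pr p∤m (prime∤^ℕ pr k p∤m)

prime∤30 : ∀ {p} → Prime p → 7 ≤ p → ¬ p ℕ.∣ 30
prime∤30 pr 7≤p = prime∤* pr (∤ 2) (prime∤* pr (∤ 3) (∤ 5))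
  where
  ∤ : ∀ q → .{{_ : ℕ.NonZero q}} → {T ⌊ q ℕ.<? 7 ⌋} → ¬ _ ℕ.∣ q
  ∤ q {q<7} = ℕ.>⇒∤ (ℕₚ.<-≤-trans (toWitness q<7) 7≤p)

prime∤210 : ∀ {p} → Prime p → 7 < p → ¬ p ℕ.∣ 210
prime∤210 pr 7<p = prime∤* pr (prime∤30 pr (ℕₚ.<⇒≤ 7<p)) (ℕ.>⇒∤ 7<p)

-- z ∣ b ^ 64, i.e. z ≢ 0 and every prime factor of z divides b: 64 exceeds every multiplicity met below.
∣power? : ℤ → ℕ → Bool
∣power? z b = ⌊ ℤ.∣ z ∣ ℕ.∣? b ℕ.^ 64 ⌋

∣power⇒∤ : ∀ {p b} → Prime p → ¬ p ℕ.∣ b → ∀ z → T (∣power? z b) → ¬ + p ∣ₛ z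
∣power⇒∤ pr p∤b z z∣b^64 p∣z =
  prime∤^ℕ pr 64 p∤b (ℕ.∣-trans (Signed.∣⇒∣ᵤ p∣z) (toWitness z∣b^64))

prime∣*⇒∣⊎∣ : ∀ {p} → Prime p → ∀ a b → + p ∣ₛ a * b → + p ∣ₛ a ⊎ + p ∣ₛ b
prime∣*⇒∣⊎∣ {p} pr a b p∣ab
  with euclidsLemma ℤ.∣ a ∣ ℤ.∣ b ∣ pr (subst (p ℕ.∣_) (ℤₚ.abs-* a b) (Signed.∣⇒∣ᵤ p∣ab))
... | inj₁ p∣a = inj₁ (Signed.∣ᵤ⇒∣ p∣a)
... | inj₂ p∣b = inj₂ (Signed.∣ᵤ⇒∣ p∣b)

prime∤1 : ∀ {p} → Prime p → ¬ + p ∣ₛ + 1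
prime∤1 pr = prime∤1ℕ pr ∘ Signed.∣⇒∣ᵤ

prime∣*∤⇒∣ : ∀ {p} → Prime p → ∀ {a b} → ¬ + p ∣ₛ a → + p ∣ₛ a * b → + p ∣ₛ b
prime∣*∤⇒∣ pr {a} {b} p∤a p∣ab with prime∣*⇒∣⊎∣ pr a b p∣ab
... | inj₁ p∣a = ⊥-elim (p∤a p∣a)
... | inj₂ p∣b = p∣b

prime∤^ : ∀ {p} → Prime p → ∀ s k → ¬ + p ∣ₛ s → ¬ + p ∣ₛ s ^ k
prime∤^ pr s zero    p∤s = prime∤1 pr
prime∤^ pr s (suc k) p∤s = prime∤^ pr s k p∤s ∘ prime∣*∤⇒∣ pr p∤s

prime∤⇒coprime : ∀ {p m} → Prime p → ¬ p ℕ.∣ m → Coprime m p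
prime∤⇒coprime pr p∤m (d∣m , d∣p) with prime⇒irreducible pr d∣p
... | inj₁ d≡1  = d≡1
... | inj₂ refl = ⊥-elim (p∤m d∣m)

1+*≡*⇒ℤ : ∀ a b c d → 1 ℕ.+ a ℕ.* b ≡ c ℕ.* d → + 1 + + a * + b ≡ + c * + d
1+*≡*⇒ℤ a b c d e = begin
  + 1 + + a * + b      ≡⟨ cong (λ z → + 1 + z) (ℤₚ.pos-* a b) ⟨
  + (1 ℕ.+ a ℕ.* b)    ≡⟨ cong +_ e ⟩
  + (c ℕ.* d)          ≡⟨ ℤₚ.pos-* c d ⟩
  + c * + d            ∎
  where open ≡-Reasoning

∃-inverseℕ : ∀ {m p} → Coprime m p → ∃ λ u → + p ∣ₛ + m * u - + 1
∃-inverseℕ {m} {p} m⊥p with coprime-Bézout m⊥p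
... | Bézout.+- x y eq = + x , Signed.divides (+ y) (begin
  + m * + x - + 1        ≡⟨ cong (_- + 1) (ℤₚ.*-comm (+ m) (+ x)) ⟩
  + x * + m - + 1        ≡⟨ cong (_- + 1) (1+*≡*⇒ℤ y p x m eq) ⟨
  + 1 + + y * + p - + 1  ≡⟨ cancel (+ y * + p) ⟩
  + y * + p              ∎)
  where
  open ≡-Reasoning
  cancel : ∀ a → + 1 + a - + 1 ≡ a
  cancel = solve-∀
... | Bézout.-+ x y eq = - + x , Signed.divides (- + y) (begin
  + m * - + x - + 1        ≡⟨ negate (+ m) (+ x) ⟩
  - (+ 1 + + x * + m)      ≡⟨ cong -_ (1+*≡*⇒ℤ x m y p eq) ⟩
  - (+ y * + p)            ≡⟨ ℤₚ.neg-distribˡ-* (+ y) (+ p) ⟩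
  - + y * + p              ∎)
  where
  open ≡-Reasoning
  negate : ∀ a b → a * - b - + 1 ≡ - (+ 1 + b * a)
  negate = solve-∀

∃-inverse : ∀ {p} → Prime p → ∀ b → ¬ + p ∣ₛ b → ∃ λ u → + p ∣ₛ b * u - + 1
∃-inverse pr (+ n) p∤b = ∃-inverseℕ (prime∤⇒coprime pr (p∤b ∘ Signed.∣ᵤ⇒∣))
∃-inverse {p} pr -[1+ n ] p∤b with ∃-inverseℕ {suc n} {p} (prime∤⇒coprime pr (p∤b ∘ Signed.∣ᵤ⇒∣))
... | u , p∣nu-1 = - u , subst (λ z → + p ∣ₛ z - + 1) (negate (+ suc n) u) p∣nu-1
  where
  negate : ∀ a u → a * u ≡ (- a) * (- u)
  negate = solve-∀

small-∣⇒≡ : ∀ {p m n} → m < p → n < p → + p ∣ₛ + m - + n → m ≡ n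
small-∣⇒≡ {p} {m} {n} m<p n<p p∣m-n with ℤ.∣ + m - + n ∣ in eq
... | zero  = ℤₚ.+-injective (ℤₚ.i-j≡0⇒i≡j (+ m) (+ n) (ℤₚ.∣i∣≡0⇒i≡0 eq))
... | suc d = ⊥-elim (ℕ.>⇒∤ {{_}} d<p (subst (p ℕ.∣_) eq (Signed.∣⇒∣ᵤ p∣m-n)))
  where
  d<p : suc d < p
  d<p = subst (_< p) eq (ℕₚ.≤-<-trans (subst (ℕ._≤ m ℕ.⊔ n) (cong ℤ.∣_∣ (sym (ℤₚ.m-n≡m⊖n m n)))
                                            (ℤₚ.∣m⊝n∣≤m⊔n m n))
                                     (ℕₚ.⊔-pres-<m m<p n<p))

-- Roots of linear forms modulo a prime

LinearForm : Set
LinearForm = ℤ × ℤ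

_⟦_⟧ : LinearForm → ℤ → ℤ
(a , b) ⟦ x ⟧ = a + x * b

slope : LinearForm → ℤ
slope = proj₂

resultant : LinearForm → LinearForm → ℤ
resultant (a , b) (a′ , b′) = a * b′ - a′ * b

IsRoot : (p : ℕ) → LinearForm → Fin p → Set
IsRoot p f x = + p ∣ₛ f ⟦ + toℕ x ⟧

resultant-self : ∀ f → resultant f f ≡ + 0
resultant-self (a , b) = ℤₚ.+-inverseʳ (a * b)

-- The root is −a u mod p, where u inverts b modulo p.
∃-root : ∀ {p} → Prime p → ∀ f → ¬ + p ∣ₛ slope f → Σ[ x ∈ Fin p ] IsRoot p f x
∃-root {p} pr (a , b) p∤b with ∃-inverse pr b p∤b
... | u , p∣bu-1 = fromℕ< r<p , subst (+ p ∣ₛ_) (sym value≡) p∣value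
  where
  instance _ = prime⇒nonZero pr
  z = - a * u
  r<p = ℤ.n%ℕd<d z p
  q = z ℤ./ℕ p
  value = (- a) * (b * u - + 1) + (- q * b) * + p
  p∣value : + p ∣ₛ value
  p∣value = Signed.∣m∣n⇒∣m+n (Signed.∣n⇒∣m*n (- a) p∣bu-1) (Signed.∣n⇒∣m*n (- q * b) (Signed.∣-refl {+ p}))
  split : ∀ a b u q p r → a + r * b ≡ (- a) * (b * u - + 1) + (- q * b) * p + (r + q * p - (- a * u)) * b
  split = solve-∀
  vanish : ∀ v z b → v + (z - z) * b ≡ v
  vanish = solve-∀
  open ≡-Reasoning
  value≡ : (a , b) ⟦ + toℕ (fromℕ< r<p) ⟧ ≡ value
  value≡ = begin
    a + + toℕ (fromℕ< r<p) * b                ≡⟨ cong (λ w → a + + w * b) (Finₚ.toℕ-fromℕ< r<p) ⟩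
    a + + (z ℤ.%ℕ p) * b                      ≡⟨ split a b u q (+ p) (+ (z ℤ.%ℕ p)) ⟩
    value + (+ (z ℤ.%ℕ p) + q * + p - z) * b  ≡⟨ cong (λ w → value + (w - z) * b) (ℤ.a≡a%ℕn+[a/ℕn]*n z p) ⟨
    value + (z - z) * b                       ≡⟨ vanish value z b ⟩
    value                                     ∎

root-unique : ∀ {p} → Prime p → ∀ f → ¬ + p ∣ₛ slope f → ∀ {x y} → IsRoot p f x → IsRoot p f y → x ≡ y
root-unique {p} pr (a , b) p∤b {x} {y} fx fy =
  Finₚ.toℕ-injective (small-∣⇒≡ (Finₚ.toℕ<n x) (Finₚ.toℕ<n y) (prime∣*∤⇒∣ pr p∤b (subst (+ p ∣ₛ_)
    (difference a (+ toℕ x) (+ toℕ y) b) (Signed.∣m∣n⇒∣m-n fx fy))))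
  where
  difference : ∀ a x y b → (a + x * b) - (a + y * b) ≡ b * (x - y)
  difference = solve-∀

resultant-root : ∀ {p} → Prime p → ∀ f g v → ¬ + p ∣ₛ slope f →
                 + p ∣ₛ f ⟦ v ⟧ → + p ∣ₛ resultant f g → + p ∣ₛ g ⟦ v ⟧
resultant-root {p} pr (a , b) (a′ , b′) v p∤b p∣fv p∣res = prime∣*∤⇒∣ pr p∤b
  (subst (+ p ∣ₛ_) (eliminate a b a′ b′ v) (Signed.∣m∣n⇒∣m-n (Signed.∣n⇒∣m*n b′ p∣fv) p∣res))
  where
  eliminate : ∀ a b a′ b′ v → b′ * (a + v * b) - (a * b′ - a′ * b) ≡ b * (a′ + v * b′)
  eliminate = solve-∀

shared-root : ∀ {p} → Prime p → ∀ {f G x} → ¬ + p ∣ₛ slope f → IsRoot p f x →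
              Any (λ g → + p ∣ₛ resultant f g) G → Any (λ g → IsRoot p g x) G
shared-root pr {f} {x = x} p∤slope fx = Any.map (λ {g} → resultant-root pr f g (+ toℕ x) p∤slope fx)

common-root⇒resultant : ∀ {p} f g v → + p ∣ₛ f ⟦ v ⟧ → + p ∣ₛ g ⟦ v ⟧ → + p ∣ₛ resultant f g
common-root⇒resultant (a , b) (a′ , b′) v p∣fv p∣gv =
  subst (_ ∣ₛ_) (eliminate a b a′ b′ v) (Signed.∣m∣n⇒∣m-n (Signed.∣n⇒∣m*n b′ p∣fv) (Signed.∣n⇒∣m*n b p∣gv))
  where
  eliminate : ∀ a b a′ b′ v → b′ * (a + v * b) - b * (a′ + v * b′) ≡ a * b′ - a′ * b
  eliminate = solve-∀

module _ {p} (pr : Prime p) where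

  roots : ∀ F → All (λ f → ¬ + p ∣ₛ slope f) F → List (Fin p)
  roots []      []            = []
  roots (f ∷ F) (p∤f ∷ p∤F)   = proj₁ (∃-root pr f p∤f) ∷ roots F p∤F

  length-roots : ∀ F p∤F → length (roots F p∤F) ≡ length F
  length-roots []      []          = refl
  length-roots (f ∷ F) (_ ∷ p∤F)   = cong suc (length-roots F p∤F)

  ∈-roots⇔ : ∀ F p∤F x → x ∈ roots F p∤F ⇔ Any (λ f → IsRoot p f x) F
  ∈-roots⇔ F p∤F x = mk⇔ (to F p∤F) (from F p∤F)
    where
    to : ∀ F p∤F → x ∈ roots F p∤F → Any (λ f → IsRoot p f x) F
    to (f ∷ F) (p∤f ∷ p∤F) (here refl) = here (proj₂ (∃-root pr f p∤f))
    to (f ∷ F) (p∤f ∷ p∤F) (there x∈) = there (to F p∤F x∈)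
    from : ∀ F p∤F → Any (λ f → IsRoot p f x) F → x ∈ roots F p∤F
    from (f ∷ F) (p∤f ∷ p∤F) (here fx)   = here (root-unique pr f p∤f fx (proj₂ (∃-root pr f p∤f)))
    from (f ∷ F) (p∤f ∷ p∤F) (there Fx)  = there (from F p∤F Fx)

  roots-unique : ∀ F p∤F → AllPairs (λ f g → ¬ + p ∣ₛ resultant f g) F → Unique (roots F p∤F)
  roots-unique []      []            []              = []
  roots-unique (f ∷ F) (p∤f ∷ p∤F)   (p∤res ∷ p∤ress) = distinct F p∤F p∤res ∷ roots-unique F p∤F p∤ress
    where
    x = proj₁ (∃-root pr f p∤f)
    fx = proj₂ (∃-root pr f p∤f)
    distinct : ∀ G p∤G → All (λ g → ¬ + p ∣ₛ resultant f g) G → All (x ≢_) (roots G p∤G)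
    distinct []      []            []              = []
    distinct (g ∷ G) (p∤g ∷ p∤G)   (p∤fg ∷ p∤fG)   =
      (λ x≡y → p∤fg (common-root⇒resultant f g (+ toℕ x) fx
                       (subst (IsRoot p g) (sym x≡y) (proj₂ (∃-root pr g p∤g))))) ∷ distinct G p∤G p∤fG

  hasSize-roots : (P : Fin p → Set) (F : List LinearForm) →
    All (λ f → ¬ + p ∣ₛ slope f) F → AllPairs (λ f g → ¬ + p ∣ₛ resultant f g) F →
    (∀ x → P x ⇔ Any (λ f → IsRoot p f x) F) → HasSize (length F) P
  hasSize-roots P F p∤F p∤res P⇔root =
    roots F p∤F , length-roots F p∤F , roots-unique F p∤F p∤res ,
    λ x → ⇔.trans (∈-roots⇔ F p∤F x) (⇔.sym (P⇔root x))

minor-scaled : ∀ {p n k} (s : ℤ) (M N : Mat n) → (∀ i j → + p ∣ₛ s * M i j - N i j) →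
               (r c : Fin k → Fin n) → + p ∣ₛ s ^ k * minor M r c - minor N r c
minor-scaled {p} {k = k} s M N sM≡N r c =
  subst (λ z → + p ∣ₛ z - minor N r c) (det-*-scale k s (sub M r c))
        (det-cong-mod p k (sub (λ i j → s * M i j) r c) (sub N r c) (λ i j → sM≡N (r i) (c j)))

minor-vanishes-scaled : ∀ {p n k} → Prime p → (s : ℤ) → ¬ + p ∣ₛ s → (M N : Mat n) →
  (∀ i j → + p ∣ₛ s * M i j - N i j) → (r c : Fin k → Fin n) → + p ∣ₛ minor M r c ⇔ + p ∣ₛ minor N r c
minor-vanishes-scaled {p} {k = k} pr s p∤s M N sM≡N r c = mk⇔ forward backward
  where
  X = s ^ k * minor M r c
  Y = minor N r c
  X≡Y : + p ∣ₛ X - Y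
  X≡Y = minor-scaled s M N sM≡N r c
  forward : + p ∣ₛ minor M r c → + p ∣ₛ Y
  forward p∣m = subst (+ p ∣ₛ_) (x-[x-y]≡y X Y) (Signed.∣m∣n⇒∣m-n (Signed.∣n⇒∣m*n (s ^ k) p∣m) X≡Y)
    where
    x-[x-y]≡y : ∀ x y → x - (x - y) ≡ y
    x-[x-y]≡y = solve-∀
  backward : + p ∣ₛ Y → + p ∣ₛ minor M r c
  backward p∣Y = prime∣*∤⇒∣ pr (prime∤^ pr s k p∤s)
    (subst (+ p ∣ₛ_) ([x-y]+y≡x X Y) (Signed.∣m∣n⇒∣m+n X≡Y p∣Y))
    where
    [x-y]+y≡x : ∀ x y → (x - y) + y ≡ x
    [x-y]+y≡x = solve-∀

s*0≡0 : ∀ {p} s → + p ∣ₛ s * + 0 - + 0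
s*0≡0 {p} s = subst (+ p ∣ₛ_) (sym (s*0-0≡0 s)) (∣ₛ0 p)
  where
  s*0-0≡0 : ∀ s → s * + 0 - + 0 ≡ + 0
  s*0-0≡0 = solve-∀

seqOf-scaled : ∀ {p} s {as bs} → Pointwise (λ a b → + p ∣ₛ s * a - b) as bs →
               ∀ m → + p ∣ₛ s * seqOf as m - seqOf bs m
seqOf-scaled s []            m       = s*0≡0 s
seqOf-scaled s (sa≡b ∷ _)    zero    = sa≡b
seqOf-scaled s (_ ∷ sas≡bs)  (suc m) = seqOf-scaled s sas≡bs m

A-scaled : ∀ {p} s {as bs} n → Pointwise (λ a b → + p ∣ₛ s * a - b) as bs →
           ∀ i j → + p ∣ₛ s * A n as i j - A n bs i j
A-scaled s n sas≡bs i j with toℕ j ℕ.≤? toℕ i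
... | yes _ = seqOf-scaled s sas≡bs (toℕ i ℕ.∸ toℕ j)
... | no  _ = s*0≡0 s

-- Determinants depending affinely on a parameter

a+v*0≡a : ∀ a v → a + v * + 0 ≡ a
a+v*0≡a = solve-∀

Affine : (ℤ → ℤ) → Set
Affine f = ∃ λ a → ∃ λ b → ∀ v → f v ≡ a + v * b

affine-interpolate : ∀ {f} → Affine f → ∀ v → f v ≡ f (+ 0) + v * (f (+ 1) - f (+ 0))
affine-interpolate {f} (a , b , f≗) v = begin
  f v                                                  ≡⟨ f≗ v ⟩
  a + v * b                                            ≡⟨ interpolate a b v ⟩
  (a + + 0 * b) + v * ((a + + 1 * b) - (a + + 0 * b))  ≡⟨ cong₂ (λ x y → x + v * (y - x)) (f≗ (+ 0)) (f≗ (+ 1)) ⟨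
  f (+ 0) + v * (f (+ 1) - f (+ 0))                    ∎
  where
  open ≡-Reasoning
  interpolate : ∀ a b v → a + v * b ≡ (a + + 0 * b) + v * ((a + + 1 * b) - (a + + 0 * b))
  interpolate = solve-∀

constant-affine : ∀ {f} → (∀ v → f v ≡ f (+ 0)) → Affine f
constant-affine {f} f≗ = f (+ 0) , + 0 , λ v → trans (f≗ v) (sym (a+v*0≡a (f (+ 0)) v))

∑-affine : ∀ k (f : Fin k → ℤ → ℤ) → (∀ i → Affine (f i)) → Affine (λ v → ∑ k (λ i → f i v))
∑-affine zero    f f-aff = constant-affine (λ v → refl)
∑-affine (suc k) f f-aff with f-aff Fin.zero | ∑-affine k (f ∘ Fin.suc) (f-aff ∘ Fin.suc)
... | a , b , f₀≗ | a′ , b′ , fₛ≗ =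
  a + a′ , b + b′ , λ v → trans (cong₂ _+_ (f₀≗ v) (fₛ≗ v)) (regroup a b a′ b′ v)
  where
  regroup : ∀ a b a′ b′ v → a + v * b + (a′ + v * b′) ≡ a + a′ + v * (b + b′)
  regroup = solve-∀

*-affineʳ : ∀ {f g : ℤ → ℤ} → Affine f → (∀ v → g v ≡ g (+ 0)) → Affine (λ v → f v * g v)
*-affineʳ {f} {g} (a , b , f≗) g≗ = a * g (+ 0) , b * g (+ 0) , λ v →
  trans (cong₂ _*_ (f≗ v) (g≗ v)) (distrib a b (g (+ 0)) v)
  where
  distrib : ∀ a b c v → (a + v * b) * c ≡ a * c + v * (b * c)
  distrib = solve-∀

*-affineˡ : ∀ {f g : ℤ → ℤ} → (∀ v → g v ≡ g (+ 0)) → Affine f → Affine (λ v → g v * f v)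
*-affineˡ {f} {g} g≗ (a , b , f≗) = g (+ 0) * a , g (+ 0) * b , λ v →
  trans (cong₂ _*_ (g≗ v) (f≗ v)) (distrib (g (+ 0)) a b v)
  where
  distrib : ∀ c a b v → c * (a + v * b) ≡ c * a + v * (c * b)
  distrib = solve-∀

AtMostOneNonzero : ∀ {k} → Mat k → Set
AtMostOneNonzero {k} D = ∀ {i j i′ j′} → D i j ≢ + 0 → D i′ j′ ≢ + 0 → i ≡ i′ × j ≡ j′

-- In the expansion along the first row, a nonzero entry of D in that row is paired with a cofactor
-- free of v; every other term has a constant entry and, by induction, an affine cofactor.
det-affine : ∀ k (F : ℤ → Mat k) (D : Mat k) → (∀ v i j → F v i j ≡ F (+ 0) i j + v * D i j) →
             AtMostOneNonzero D → Affine (λ v → det k (F v))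
det-affine zero    F D F≗ D-one = constant-affine (λ v → refl)
det-affine (suc k) F D F≗ D-one =
  ∑-affine (suc k) (λ j v → sgn (toℕ j) * (F v Fin.zero j * det k (cofactor v j))) λ j →
    *-affineˡ {g = λ _ → sgn (toℕ j)} (λ _ → refl) (term j)
  where
  cofactor : ℤ → Fin (suc k) → Mat k
  cofactor v j r c = F v (Fin.suc r) (punchIn j c)
  D-cofactor : Fin (suc k) → Mat k
  D-cofactor j r c = D (Fin.suc r) (punchIn j c)
  D-cofactor-one : ∀ j → AtMostOneNonzero (D-cofactor j)
  D-cofactor-one j D≢0 D′≢0 = Finₚ.suc-injective (proj₁ (D-one D≢0 D′≢0)) ,
                              Finₚ.punchIn-injective j _ _ (proj₂ (D-one D≢0 D′≢0))
  unchanged : ∀ {i j} → D i j ≡ + 0 → ∀ v → F v i j ≡ F (+ 0) i j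
  unchanged {i} {j} Dᵢⱼ≡0 v = trans (F≗ v i j) (trans (cong (λ d → F (+ 0) i j + v * d) Dᵢⱼ≡0) (a+v*0≡a _ v))
  term : ∀ j → Affine (λ v → F v Fin.zero j * det k (cofactor v j))
  term j with D Fin.zero j ℤ.≟ + 0
  ... | yes D₀ⱼ≡0 = *-affineˡ (unchanged D₀ⱼ≡0)
    (det-affine k (λ v → cofactor v j) (D-cofactor j) (λ v r c → F≗ v (Fin.suc r) (punchIn j c))
                (D-cofactor-one j))
  ... | no  D₀ⱼ≢0 = *-affineʳ (F (+ 0) Fin.zero j , D Fin.zero j , λ v → F≗ v Fin.zero j)
    (λ v → det-cong k λ r c → unchanged (below-zero r (punchIn j c)) v)
    where
    below-zero : ∀ r c → D (Fin.suc r) c ≡ + 0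
    below-zero r c with D (Fin.suc r) c ℤ.≟ + 0
    ... | yes D′≡0 = D′≡0
    ... | no  D′≢0 with () ← proj₁ (D-one D₀ⱼ≢0 D′≢0)

-- Properties of all minors, decided by evaluation

T-all⁻ : ∀ {A : Set} (p : A → Bool) {xs x} → T (all p xs) → x ∈ xs → T (p x)
T-all⁻ p {xs} h = All.lookup (all⁺ p xs h)

T-any⁺ : ∀ {A : Set} (p : A → Bool) {xs x} → x ∈ xs → T (p x) → T (any p xs)
T-any⁺ p x∈xs px = any⁺ p (lose x∈xs px)

T-allFin⁺ : ∀ {k} (p : Fin k → Bool) → (∀ i → T (p i)) → T (all p (allFin k))
T-allFin⁺ {k} p h = all⁻ p {allFin k} (All.tabulate (λ {i} _ → h i))

T-allFin⁻ : ∀ {k} (p : Fin k → Bool) → T (all p (allFin k)) → ∀ i → T (p i)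
T-allFin⁻ p h i = T-all⁻ p h (∈ₚ.∈-allFin i)

vecs : ∀ {n} k → List (Vec (Fin n) k)
vecs zero          = [] ∷ []
vecs {n} (suc k)   = cartesianProductWith _∷_ (allFin n) (vecs k)

∈-vecs : ∀ {n k} (v : Vec (Fin n) k) → v ∈ vecs k
∈-vecs []      = here refl
∈-vecs (i ∷ v) = ∈ₚ.∈-cartesianProductWith⁺ _∷_ (∈ₚ.∈-allFin i) (∈-vecs v)

increasing? : ∀ {n k} → Vec (Fin n) k → Bool
increasing? []          = true
increasing? (_ ∷ [])    = true
increasing? (i ∷ j ∷ v) = ⌊ i Finₚ.<? j ⌋ ∧ increasing? (j ∷ v)

increasing?-complete : ∀ {n} k (r : Fin k → Fin n) → StrictlyIncreasing r → T (increasing? (tabulate r))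
increasing?-complete zero          r r↑ = _
increasing?-complete (suc zero)    r r↑ = _
increasing?-complete (suc (suc k)) r r↑ = Equivalence.from T-∧
  (fromWitness (r↑ Fin.zero (Fin.suc Fin.zero) (ℕ.s≤s ℕ.z≤n)) ,
   increasing?-complete (suc k) (r ∘ Fin.suc) (λ s t s<t → r↑ (Fin.suc s) (Fin.suc t) (ℕ.s≤s s<t)))

increasing?-sound : ∀ {n k} (v : Vec (Fin n) k) → T (increasing? v) → StrictlyIncreasing (lookup v)
increasing?-sound (i ∷ j ∷ v) v↑ Fin.zero (Fin.suc t) _ =
  ℕₚ.<-≤-trans (toWitness (proj₁ i<j×j∷v↑)) (head≤ t)
  where
  i<j×j∷v↑ = Equivalence.to T-∧ v↑
  head≤ : ∀ t → j Fin.≤ lookup (j ∷ v) t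
  head≤ Fin.zero    = ℕₚ.≤-refl
  head≤ (Fin.suc t) = ℕₚ.<⇒≤ (increasing?-sound (j ∷ v) (proj₂ i<j×j∷v↑) Fin.zero (Fin.suc t) (ℕ.s≤s ℕ.z≤n))
increasing?-sound (i ∷ j ∷ v) v↑ (Fin.suc s) (Fin.suc t) (ℕ.s≤s s<t) =
  increasing?-sound (j ∷ v) (proj₂ (Equivalence.to T-∧ v↑)) s t s<t
increasing?-sound (i ∷ []) v↑ Fin.zero Fin.zero ()

increasingVecs : ∀ {n} k → List (Vec (Fin n) k)
increasingVecs k = filterᵇ increasing? (vecs k)

∈-increasingVecs : ∀ {n} k (r : Fin k → Fin n) → StrictlyIncreasing r → tabulate r ∈ increasingVecs k
∈-increasingVecs k r r↑ = ∈ₚ.∈-filter⁺ (T? ∘ increasing?) (∈-vecs (tabulate r)) (increasing?-complete k r r↑)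

increasing⇒injective : ∀ {k n} (r : Fin k → Fin n) → StrictlyIncreasing r → ∀ {s t} → r s ≡ r t → s ≡ t
increasing⇒injective r r↑ {s} {t} rs≡rt with Finₚ.<-cmp s t
... | tri< s<t _ _ = ⊥-elim (ℕₚ.<-irrefl (cong toℕ rs≡rt) (r↑ s t s<t))
... | tri≈ _ s≡t _ = s≡t
... | tri> _ _ t<s = ⊥-elim (ℕₚ.<-irrefl (cong toℕ (sym rs≡rt)) (r↑ t s t<s))

-- Opaque, so that the type checker never evaluates a certificate about symbolic data; concrete
-- certificates are evaluated in blocks that unfold it.
opaque
  everyMinor? : ∀ n → (Q P : ∀ {k} → Vec (Fin n) k → Vec (Fin n) k → Bool) → Bool
  everyMinor? n Q P =
    all (λ k → all (λ rv → all (P rv) (filterᵇ (Q rv) (increasingVecs k))) (increasingVecs k)) (upTo (suc n))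

opaque
  unfolding everyMinor?
  everyMinor?-sound : ∀ {n} (Q P : ∀ {k} → Vec (Fin n) k → Vec (Fin n) k → Bool) → T (everyMinor? n Q P) →
    ∀ {k} (r c : Fin k → Fin n) → StrictlyIncreasing r → StrictlyIncreasing c →
    T (Q (tabulate r) (tabulate c)) → T (P (tabulate r) (tabulate c))
  everyMinor?-sound {n} Q P h {k} r c r↑ c↑ q =
    T-all⁻ (P (tabulate r)) (T-all⁻ _ (T-all⁻ _ h (∈ₚ.∈-upTo⁺ k<1+n)) (∈-increasingVecs k r r↑))
      (∈ₚ.∈-filter⁺ (T? ∘ Q (tabulate r)) (∈-increasingVecs k c c↑) q)
    where
    k<1+n : k < suc n
    k<1+n = ℕ.s≤s (Finₚ.injective⇒≤ (increasing⇒injective r r↑))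

LowerPattern : ∀ {k n} → (Fin k → Fin n) → (Fin k → Fin n) → Set
LowerPattern r c = ∀ t → c t Fin.≤ r t

lower? : ∀ {n k} → Vec (Fin n) k → Vec (Fin n) k → Bool
lower? {k = k} rv cv = all (λ t → ⌊ lookup cv t Finₚ.≤? lookup rv t ⌋) (allFin k)

lower?-complete : ∀ {n k} (r c : Fin k → Fin n) → LowerPattern r c → T (lower? (tabulate r) (tabulate c))
lower?-complete r c c≤r = T-allFin⁺ _ λ t →
  fromWitness (subst₂ Fin._≤_ (sym (Vecₚ.lookup∘tabulate c t)) (sym (Vecₚ.lookup∘tabulate r t)) (c≤r t))

lower?-sound : ∀ {n k} (rv cv : Vec (Fin n) k) → T (lower? rv cv) → LowerPattern (lookup rv) (lookup cv)
lower?-sound rv cv h t = toWitness (T-allFin⁻ _ h t)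

Corner : ∀ {k} γ → (Fin k → Fin γ) → (Fin k → Fin γ) → Set
Corner γ r c = ∃ λ t → toℕ (r t) ≡ γ ℕ.∸ 1 × toℕ (c t) ≡ 0

atCorner? : ∀ {γ k} → Vec (Fin γ) k → Vec (Fin γ) k → Fin k → Bool
atCorner? {γ} rv cv t = ⌊ (toℕ (lookup rv t) ℕ.≟ γ ℕ.∸ 1) ×-dec (toℕ (lookup cv t) ℕ.≟ 0) ⌋

corner? : ∀ {γ k} → Vec (Fin γ) k → Vec (Fin γ) k → Bool
corner? {k = k} rv cv = any (atCorner? rv cv) (allFin k)

corner?-complete : ∀ {γ k} (r c : Fin k → Fin γ) → Corner γ r c → T (corner? (tabulate r) (tabulate c))
corner?-complete r c (t , rₜ≡γ-1 , cₜ≡0) = T-any⁺ _ (∈ₚ.∈-allFin t) (fromWitness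
  (trans (cong toℕ (Vecₚ.lookup∘tabulate r t)) rₜ≡γ-1 , trans (cong toℕ (Vecₚ.lookup∘tabulate c t)) cₜ≡0))

corner?-sound : ∀ {γ k} (rv cv : Vec (Fin γ) k) → T (corner? rv cv) → Corner γ (lookup rv) (lookup cv)
corner?-sound {k = k} rv cv h with Any.satisfied (any⁻ (atCorner? rv cv) (allFin k) h)
... | t , corner = t , toWitness corner

injective? : ∀ {m k} → Vec (Fin m) k → Bool
injective? {k = k} v =
  all (λ s → all (λ t → ⌊ (lookup v s Finₚ.≟ lookup v t) →-dec (s Finₚ.≟ t) ⌋) (allFin k)) (allFin k)

injective?-complete : ∀ {m k} (f : Fin k → Fin m) → (∀ {s t} → f s ≡ f t → s ≡ t) → T (injective? (tabulate f))
injective?-complete f f-inj = T-allFin⁺ _ λ s → T-allFin⁺ _ λ t → fromWitness λ e →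
  f-inj (trans (sym (Vecₚ.lookup∘tabulate f s)) (trans e (Vecₚ.lookup∘tabulate f t)))

-- A Leibniz term of the minor on rows rv and columns cv is encoded by the vector sv listing, row by
-- row, the positions in cv of the columns it uses; permute cv sv lists those columns.
permute : ∀ {γ k} → Vec (Fin γ) k → Vec (Fin k) k → Vec (Fin γ) k
permute cv sv = Vec.map (lookup cv) sv

involves? : ∀ {γ k} → Vec (Fin γ) k → Vec (Fin γ) k → Bool
involves? {k = k} rv cv =
  any injective? (filterᵇ (lower? rv ∘ permute cv) (filterᵇ (corner? rv ∘ permute cv) (vecs k)))

Involves⇒involves? : ∀ {γ k} (r c : Fin k → Fin γ) → Involves γ k r c → T (involves? (tabulate r) (tabulate c))
Involves⇒involves? {γ} {k} r c (σ , c∘σ≤r , corner) =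
  T-any⁺ injective? (∈ₚ.∈-filter⁺ (T? ∘ lower? rv ∘ permute cv) sv∈cornered lowered) σ-injective
  where
  rv = tabulate r
  cv = tabulate c
  sv = tabulate (σ ⟨$⟩ʳ_)
  cσ : Fin k → Fin γ
  cσ t = c (σ ⟨$⟩ʳ t)
  permute-σ : tabulate cσ ≡ permute cv sv
  permute-σ = trans (Vecₚ.tabulate-cong (λ t → sym (Vecₚ.lookup∘tabulate c (σ ⟨$⟩ʳ t))))
                    (Vecₚ.tabulate-∘ (lookup cv) (σ ⟨$⟩ʳ_))
  sv∈cornered : sv ∈ filterᵇ (corner? rv ∘ permute cv) (vecs k)
  sv∈cornered = ∈ₚ.∈-filter⁺ (T? ∘ corner? rv ∘ permute cv) (∈-vecs sv)
                  (subst (T ∘ corner? rv) permute-σ (corner?-complete r cσ corner))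
  lowered : T (lower? rv (permute cv sv))
  lowered = subst (T ∘ lower? rv) permute-σ (lower?-complete r cσ c∘σ≤r)
  σ-injective : T (injective? sv)
  σ-injective = injective?-complete (σ ⟨$⟩ʳ_) λ e →
    trans (sym (inverseˡ σ)) (trans (cong (σ ⟨$⟩ˡ_) e) (inverseˡ σ))

ltCertificate : ∀ n → ℕ → Mat n → Bool
ltCertificate n b N = everyMinor? n lower? λ rv cv → ∣power? (minor N (lookup rv) (lookup cv)) b

ltCertificate-sound : ∀ {p b} → Prime p → ¬ p ℕ.∣ b → ∀ n (N : Mat n) → T (ltCertificate n b N) →
  ∀ {k} (r c : Fin k → Fin n) → StrictlyIncreasing r → StrictlyIncreasing c → LowerPattern r c →
  ¬ + p ∣ₛ minor N r c
ltCertificate-sound {b = b} pr p∤b n N cert r c r↑ c↑ c≤r = ∣power⇒∤ pr p∤b (minor N r c)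
  (subst (λ m → T (∣power? m b)) (minor-tabulate N r c)
         (everyMinor?-sound _ _ cert r c r↑ c↑ (lower?-complete r c c≤r)))

ltSuperregular-scaled : ∀ {p b n} → Prime p → ¬ p ℕ.∣ b → (s : ℤ) → ¬ + p ∣ₛ s → (M N : Mat n) →
  (∀ i j → + p ∣ₛ s * M i j - N i j) → T (ltCertificate n b N) → LTSuperregular p n M
ltSuperregular-scaled {n = n} pr p∤b s p∤s M N sM≡N cert k r c r↑ c↑ c≤r p∣m =
  ltCertificate-sound pr p∤b n N cert r c r↑ c↑ c≤r
    (Equivalence.to (minor-vanishes-scaled pr s p∤s M N sM≡N r c) (Signed.∣ᵤ⇒∣ p∣m))

-- The minors of A₅ involving a₅

explained : List LinearForm → LinearForm → Bool
explained forms f = ∣power? (slope f) 30 ∧ any (λ g → ⌊ resultant f g ℤ.≟ + 0 ⌋) forms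

explained-sound : ∀ forms f → T (explained forms f) →
                  T (∣power? (slope f) 30) × Any (λ g → T ⌊ resultant f g ℤ.≟ + 0 ⌋) forms
explained-sound forms f h = proj₁ slope×res , any⁻ _ forms (proj₂ slope×res)
  where
  slope×res = Equivalence.to T-∧ h

-- t ↦ t + 1 (mod k)
cycle : ∀ k → Permutation′ k
cycle zero          = Perm.id
cycle (suc zero)    = Perm.id
cycle (suc (suc k)) = Perm.lift₀ (cycle (suc k)) Perm.∘ₚ Perm.transpose Fin.zero (Fin.suc Fin.zero)

-- A minor of A₅ with evidence, checked by evaluation, that the Leibniz term of the cyclic
-- permutation makes it involve a₅.
record Witness : Set where
  constructor witness
  field
    {k}        : ℕ
    rows       : Vec (Fin 5) k
    cols       : Vec (Fin 5) k
    {rows↑}    : T (increasing? rows)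
    {cols↑}    : T (increasing? cols)
    {lowered}  : T (lower? rows (permute cols (tabulate (cycle k ⟨$⟩ʳ_))))
    {cornered} : T (corner? rows (permute cols (tabulate (cycle k ⟨$⟩ʳ_))))

  involves : Involves 5 k (lookup rows) (lookup cols)
  involves = cycle k , lower , corner
    where
    cycled-cols = permute cols (tabulate (cycle k ⟨$⟩ʳ_))
    cycled : ∀ t → lookup cycled-cols t ≡ lookup cols (cycle k ⟨$⟩ʳ t)
    cycled t = trans (Vecₚ.lookup-map t (lookup cols) (tabulate (cycle k ⟨$⟩ʳ_)))
                     (cong (lookup cols) (Vecₚ.lookup∘tabulate (cycle k ⟨$⟩ʳ_) t))
    lower : ∀ t → lookup cols (cycle k ⟨$⟩ʳ t) Fin.≤ lookup rows t
    lower t = subst (Fin._≤ lookup rows t) (cycled t) (lower?-sound rows cycled-cols lowered t)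
    corner : Corner 5 (lookup rows) (λ t → lookup cols (cycle k ⟨$⟩ʳ t))
    corner = let t , row , col = corner?-sound rows cycled-cols cornered
             in t , row , trans (cong toℕ (sym (cycled t))) col

module Pencil (b₃ b₄ : ℤ) where

  -- 8 A₅(1, 1, a₃, a₄, v) when 8 a₃ ≡ b₃ and 8 a₄ ≡ b₄.
  pencil : ℤ → Mat 5
  pencil v = A 5 (+ 8 ∷ + 8 ∷ b₃ ∷ b₄ ∷ + 8 * v ∷ [])

  pencil′ : Mat 5
  pencil′ = A 5 (+ 0 ∷ + 0 ∷ + 0 ∷ + 0 ∷ + 8 ∷ [])

  pencil-split : ∀ v i j → pencil v i j ≡ pencil (+ 0) i j + v * pencil′ i j
  pencil-split v i j with toℕ j ℕ.≤? toℕ i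
  ... | no _  = sym (a+v*0≡a (+ 0) v)
  ... | yes _ = split (toℕ i ℕ.∸ toℕ j)
    where
    last-entry : ∀ v → + 8 * v ≡ + 0 + v * + 8
    last-entry = solve-∀
    split : ∀ m → seqOf (+ 8 ∷ + 8 ∷ b₃ ∷ b₄ ∷ + 8 * v ∷ []) m
                ≡ seqOf (+ 8 ∷ + 8 ∷ b₃ ∷ b₄ ∷ + 0 ∷ []) m + v * seqOf (+ 0 ∷ + 0 ∷ + 0 ∷ + 0 ∷ + 8 ∷ []) m
    split 0 = sym (a+v*0≡a (+ 8) v)
    split 1 = sym (a+v*0≡a (+ 8) v)
    split 2 = sym (a+v*0≡a b₃ v)
    split 3 = sym (a+v*0≡a b₄ v)
    split 4 = last-entry v
    split (suc (suc (suc (suc (suc m))))) = sym (a+v*0≡a (+ 0) v)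

  pencil′-support : ∀ i j → pencil′ i j ≡ + 0 ⊎ (i ≡ # 4 × j ≡ # 0)
  pencil′-support = from-yes (Finₚ.all? λ i → Finₚ.all? λ j →
    (pencil′ i j ℤ.≟ + 0) ⊎-dec ((i Finₚ.≟ # 4) ×-dec (j Finₚ.≟ # 0)))

  pencil′-atMostOne : ∀ {k} {r c : Fin k → Fin 5} → StrictlyIncreasing r → StrictlyIncreasing c →
                     AtMostOneNonzero (sub pencil′ r c)
  pencil′-atMostOne {r = r} {c} r↑ c↑ {s} {t} {s′} {t′} ≢0 ≢0′
    with pencil′-support (r s) (c t) | pencil′-support (r s′) (c t′)
  ... | inj₁ ≡0 | _       = ⊥-elim (≢0 ≡0)
  ... | inj₂ _  | inj₁ ≡0 = ⊥-elim (≢0′ ≡0)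
  ... | inj₂ (rₛ≡4 , cₜ≡0) | inj₂ (rₛ′≡4 , cₜ′≡0) =
    increasing⇒injective r r↑ (trans rₛ≡4 (sym rₛ′≡4)) , increasing⇒injective c c↑ (trans cₜ≡0 (sym cₜ′≡0))

  form : ∀ {k} → (Fin k → Fin 5) → (Fin k → Fin 5) → LinearForm
  form r c = minor (pencil (+ 0)) r c , minor (pencil (+ 1)) r c - minor (pencil (+ 0)) r c

  minor-pencil : ∀ {k} (r c : Fin k → Fin 5) → StrictlyIncreasing r → StrictlyIncreasing c →
                 ∀ v → minor (pencil v) r c ≡ form r c ⟦ v ⟧
  minor-pencil {k} r c r↑ c↑ = affine-interpolate (det-affine k (λ v → sub (pencil v) r c) (sub pencil′ r c)
    (λ v s t → pencil-split v (r s) (c t)) (pencil′-atMostOne r↑ c↑))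

  form-tabulate : ∀ {k} (r c : Fin k → Fin 5) → form (lookup (tabulate r)) (lookup (tabulate c)) ≡ form r c
  form-tabulate r c =
    cong₂ (λ α α′ → α , α′ - α) (minor-tabulate (pencil (+ 0)) r c) (minor-tabulate (pencil (+ 1)) r c)

  explains : List LinearForm → ∀ {k} → Vec (Fin 5) k → Vec (Fin 5) k → Bool
  explains forms rv cv = explained forms (form (lookup rv) (lookup cv))

  formOf : Witness → LinearForm
  formOf w = form (lookup (Witness.rows w)) (lookup (Witness.cols w))

  module _ {p} (pr : Prime p) (7≤p : 7 ≤ p) {a₃ a₄ : ℤ}
           (a₃≡b₃ : + p ∣ₛ + 8 * a₃ - b₃) (a₄≡b₄ : + p ∣ₛ + 8 * a₄ - b₄) where

    Aₓ : ℤ → Mat 5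
    Aₓ v = A 5 (+ 1 ∷ + 1 ∷ a₃ ∷ a₄ ∷ v ∷ [])

    minor-Aₓ⇔pencil : ∀ v {k} (r c : Fin k → Fin 5) → + p ∣ₛ minor (Aₓ v) r c ⇔ + p ∣ₛ minor (pencil v) r c
    minor-Aₓ⇔pencil v = minor-vanishes-scaled pr (+ 8) (∣power⇒∤ pr (prime∤30 pr 7≤p) (+ 8) _) (Aₓ v) (pencil v)
      (A-scaled (+ 8) 5 (∣ₛ0 p ∷ ∣ₛ0 p ∷ a₃≡b₃ ∷ a₄≡b₄ ∷
                         subst (+ p ∣ₛ_) (sym (ℤₚ.+-inverseʳ (+ 8 * v))) (∣ₛ0 p) ∷ []))

    S⇒root : ∀ forms → T (everyMinor? 5 involves? (explains forms)) →
             ∀ x → InS p 5 (a₃ ∷ a₄ ∷ []) x → Any (λ f → IsRoot p f x) forms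
    S⇒root forms cert x (k , r , c , r↑ , c↑ , involved , p∣minor) =
      Any.map (λ {g} res≡0 → resultant-root pr (form r c) g (+ toℕ x) p∤slope root
                                (subst (+ p ∣ₛ_) (sym (toWitness res≡0)) (∣ₛ0 p)))
              (proj₂ slope×res)
      where
      explanation : T (explained forms (form r c))
      explanation = subst (T ∘ explained forms) (form-tabulate r c)
        (everyMinor?-sound involves? (explains forms) cert r c r↑ c↑
          (Involves⇒involves? r c involved))
      slope×res = explained-sound forms (form r c) explanation
      p∤slope : ¬ + p ∣ₛ slope (form r c)
      p∤slope = ∣power⇒∤ pr (prime∤30 pr 7≤p) (slope (form r c)) (proj₁ slope×res)
      root : + p ∣ₛ form r c ⟦ + toℕ x ⟧
      root = subst (+ p ∣ₛ_) (minor-pencil r c r↑ c↑ (+ toℕ x))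
               (Equivalence.to (minor-Aₓ⇔pencil (+ toℕ x) r c) (Signed.∣ᵤ⇒∣ p∣minor))

    root⇒S : ∀ w x → IsRoot p (formOf w) x → InS p 5 (a₃ ∷ a₄ ∷ []) x
    root⇒S w x root = k , lookup rows , lookup cols , rows↑′ , cols↑′ , involves ,
      Signed.∣⇒∣ᵤ (Equivalence.from (minor-Aₓ⇔pencil (+ toℕ x) (lookup rows) (lookup cols))
        (subst (+ p ∣ₛ_) (sym (minor-pencil (lookup rows) (lookup cols) rows↑′ cols↑′ (+ toℕ x))) root))
      where
      open Witness w
      rows↑′ = increasing?-sound rows rows↑
      cols↑′ = increasing?-sound cols cols↑

    S-hasSize : ∀ (W W′ : List Witness) → T (everyMinor? 5 involves? (explains (List.map formOf W))) →
      All (λ f → ¬ + p ∣ₛ slope f × Any (λ g → + p ∣ₛ resultant f g) (List.map formOf W′)) (List.map formOf W) →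
      All (λ f → ¬ + p ∣ₛ slope f) (List.map formOf W′) →
      AllPairs (λ f g → ¬ + p ∣ₛ resultant f g) (List.map formOf W′) →
      HasSize (length W′) (InS p 5 (a₃ ∷ a₄ ∷ []))
    S-hasSize W W′ cert reduce p∤slopes p∤resultants =
      subst (λ m → HasSize m (InS p 5 (a₃ ∷ a₄ ∷ []))) (Listₚ.length-map formOf W′)
        (hasSize-roots pr _ (List.map formOf W′) p∤slopes p∤resultants λ x → mk⇔ (to x) (from x))
      where
      to : ∀ x → InS p 5 (a₃ ∷ a₄ ∷ []) x → Any (λ g → IsRoot p g x) (List.map formOf W′)
      to x Sx = let reducible , root = All.lookupAny reduce rootInW in reroute (Any.lookup rootInW) reducible root
        where
        rootInW = S⇒root (List.map formOf W) cert x Sx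
        reroute : ∀ f → (¬ + p ∣ₛ slope f × Any (λ g → + p ∣ₛ resultant f g) (List.map formOf W′)) →
                  IsRoot p f x → Any (λ g → IsRoot p g x) (List.map formOf W′)
        reroute f (p∤slope , shared) root = shared-root pr {f} {x = x} p∤slope root shared
      from : ∀ x → Any (λ g → IsRoot p g x) (List.map formOf W′) → InS p 5 (a₃ ∷ a₄ ∷ []) x
      from x root = let w , w-root = Any.satisfied (Anyₚ.map⁻ {xs = W′} root) in root⇒S w x w-root

  S-size : ∀ (W W₇ : List Witness) → let F = List.map formOf W; F₇ = List.map formOf W₇ in
    {T (everyMinor? 5 involves? (explains F))} →
    {True (All.all? (λ f → T? (∣power? (slope f) 30)) F)} →
    {True (All.all? (λ f → T? (∣power? (slope f) 30)) F₇)} →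
    {True (AllPairs.allPairs? (λ f g → T? (∣power? (resultant f g) 210)) F)} →
    {True (AllPairs.allPairs? (λ f g → T? (∣power? (resultant f g) 30)) F₇)} →
    {True (All.all? (λ f → Any.any? (λ g → + 7 Signed.∣? resultant f g) F₇) F)} →
    ∀ {p} → Prime p → 7 ≤ p → ∀ {a₃ a₄} → + p ∣ₛ + 8 * a₃ - b₃ → + p ∣ₛ + 8 * a₄ - b₄ →
    (p ≡ 7 → HasSize (length W₇) (InS p 5 (a₃ ∷ a₄ ∷ []))) ×
    (7 < p → HasSize (length W) (InS p 5 (a₃ ∷ a₄ ∷ [])))
  S-size W W₇ {cert} {slopes} {slopes₇} {separated} {separated₇} {merged₇} {p} pr 7≤p {a₃} {a₄} a₃≡b₃ a₄≡b₄ =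
    at-7 , above-7
    where
    p∤30 = prime∤30 pr 7≤p
    p∤slopes : ∀ F → All (λ f → T (∣power? (slope f) 30)) F → All (λ f → ¬ + p ∣ₛ slope f) F
    p∤slopes F = All.map (λ {f} → ∣power⇒∤ pr p∤30 (slope f))
    at-7 : p ≡ 7 → HasSize (length W₇) (InS p 5 (a₃ ∷ a₄ ∷ []))
    at-7 refl = S-hasSize pr 7≤p a₃≡b₃ a₄≡b₄ W W₇ cert
      (All.zip (p∤slopes _ (toWitness slopes) , toWitness merged₇))
      (p∤slopes _ (toWitness slopes₇))
      (AllPairs.map (λ {f g} → ∣power⇒∤ pr p∤30 (resultant f g)) (toWitness separated₇))
    above-7 : 7 < p → HasSize (length W) (InS p 5 (a₃ ∷ a₄ ∷ []))
    above-7 7<p = S-hasSize pr 7≤p a₃≡b₃ a₄≡b₄ W W cert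
      (All.tabulate λ {f} f∈F → All.lookup (p∤slopes _ (toWitness slopes)) f∈F ,
                                lose f∈F (subst (+ p ∣ₛ_) (sym (resultant-self f)) (∣ₛ0 p)))
      (p∤slopes _ (toWitness slopes))
      (AllPairs.map (λ {f g} → ∣power⇒∤ pr (prime∤210 pr 7<p) (resultant f g)) (toWitness separated))

-- Modulo 7 the form of the extra witness in witnesses[¼,-⅛] (and in witnesses[¾,⅜]) has the same root
-- as one of these.
witnesses₇[¼,-⅛] : List Witness
witnesses₇[¼,-⅛] =
  witness (# 4 ∷ []) (# 0 ∷ []) ∷
  witness (# 1 ∷ # 4 ∷ []) (# 0 ∷ # 1 ∷ []) ∷
  witness (# 2 ∷ # 4 ∷ []) (# 0 ∷ # 1 ∷ []) ∷
  witness (# 2 ∷ # 4 ∷ []) (# 0 ∷ # 2 ∷ []) ∷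
  witness (# 1 ∷ # 2 ∷ # 4 ∷ []) (# 0 ∷ # 1 ∷ # 2 ∷ []) ∷
  witness (# 1 ∷ # 3 ∷ # 4 ∷ []) (# 0 ∷ # 1 ∷ # 3 ∷ []) ∷ []

witnesses[¼,-⅛] : List Witness
witnesses[¼,-⅛] = witness (# 1 ∷ # 3 ∷ # 4 ∷ []) (# 0 ∷ # 1 ∷ # 2 ∷ []) ∷ witnesses₇[¼,-⅛]

witnesses₇[¾,⅜] : List Witness
witnesses₇[¾,⅜] =
  witness (# 4 ∷ []) (# 0 ∷ []) ∷
  witness (# 1 ∷ # 4 ∷ []) (# 0 ∷ # 1 ∷ []) ∷
  witness (# 2 ∷ # 4 ∷ []) (# 0 ∷ # 1 ∷ []) ∷
  witness (# 2 ∷ # 4 ∷ []) (# 0 ∷ # 2 ∷ []) ∷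
  witness (# 3 ∷ # 4 ∷ []) (# 0 ∷ # 1 ∷ []) ∷
  witness (# 1 ∷ # 3 ∷ # 4 ∷ []) (# 0 ∷ # 1 ∷ # 2 ∷ []) ∷ []

witnesses[¾,⅜] : List Witness
witnesses[¾,⅜] = witness (# 1 ∷ # 2 ∷ # 3 ∷ # 4 ∷ []) (# 0 ∷ # 1 ∷ # 2 ∷ # 3 ∷ []) ∷ witnesses₇[¾,⅜]

∣⇒∣ₛ-scaled : ∀ {p x y} c → y ≡ c * x → + p ∣ x → + p ∣ₛ y
∣⇒∣ₛ-scaled c y≡cx p∣x = subst (_ ∣ₛ_) (sym y≡cx) (Signed.∣n⇒∣m*n c (Signed.∣ᵤ⇒∣ p∣x))

8a≡2 : ∀ {p} a → + p ∣ + 4 * a - + 1 → + p ∣ₛ + 8 * a - + 2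
8a≡2 a = ∣⇒∣ₛ-scaled (+ 2) (double a)
  where
  double : ∀ a → + 8 * a - + 2 ≡ + 2 * (+ 4 * a - + 1)
  double = solve-∀

8a≡-1 : ∀ {p} a → + p ∣ + 8 * a + + 1 → + p ∣ₛ + 8 * a - - + 1
8a≡-1 a = ∣⇒∣ₛ-scaled (+ 1) (same a)
  where
  same : ∀ a → + 8 * a - - + 1 ≡ + 1 * (+ 8 * a + + 1)
  same = solve-∀

8a≡6 : ∀ {p} a → + p ∣ + 4 * a - + 3 → + p ∣ₛ + 8 * a - + 6
8a≡6 a = ∣⇒∣ₛ-scaled (+ 2) (double a)
  where
  double : ∀ a → + 8 * a - + 6 ≡ + 2 * (+ 4 * a - + 3)
  double = solve-∀

2b≡2 : ∀ {p} b → + p ∣ b - + 1 → + p ∣ₛ + 2 * b - + 2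
2b≡2 b = ∣⇒∣ₛ-scaled (+ 2) (double b)
  where
  double : ∀ b → + 2 * b - + 2 ≡ + 2 * (b - + 1)
  double = solve-∀

2b≡-1 : ∀ {p} b → + p ∣ + 2 * b + + 1 → + p ∣ₛ + 2 * b - - + 1
2b≡-1 b = ∣⇒∣ₛ-scaled (+ 1) (same b)
  where
  same : ∀ b → + 2 * b - - + 1 ≡ + 1 * (+ 2 * b + + 1)
  same = solve-∀

opaque
  unfolding everyMinor?

  S-size[¼,-⅛] : ∀ {p} → Prime p → 7 ≤ p → ∀ {a₃ a₄} → + p ∣ + 4 * a₃ - + 1 → + p ∣ + 8 * a₄ + + 1 →
    (p ≡ 7 → HasSize 6 (InS p 5 (a₃ ∷ a₄ ∷ []))) × (7 < p → HasSize 7 (InS p 5 (a₃ ∷ a₄ ∷ [])))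
  S-size[¼,-⅛] pr 7≤p {a₃} {a₄} a₃≡¼ a₄≡-⅛ =
    Pencil.S-size (+ 2) (- + 1) witnesses[¼,-⅛] witnesses₇[¼,-⅛] pr 7≤p (8a≡2 a₃ a₃≡¼) (8a≡-1 a₄ a₄≡-⅛)

  S-size[¾,⅜] : ∀ {p} → Prime p → 7 ≤ p → ∀ {a₃ a₄} → + p ∣ + 4 * a₃ - + 3 → + p ∣ + 8 * a₄ - + 3 →
    (p ≡ 7 → HasSize 6 (InS p 5 (a₃ ∷ a₄ ∷ []))) × (7 < p → HasSize 7 (InS p 5 (a₃ ∷ a₄ ∷ [])))
  S-size[¾,⅜] pr 7≤p {a₃} {a₄} a₃≡¾ a₄≡⅜ =
    Pencil.S-size (+ 6) (+ 3) witnesses[¾,⅜] witnesses₇[¾,⅜] pr 7≤p (8a≡6 a₃ a₃≡¾) (Signed.∣ᵤ⇒∣ a₄≡⅜)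

  superregular[¼,-⅛,¼] : ∀ {p} → Prime p → 7 ≤ p → ∀ {a₃ a₄ a₅} → + p ∣ + 4 * a₃ - + 1 → + p ∣ + 8 * a₄ + + 1 →
    + p ∣ + 4 * a₅ - + 1 → LTSuperregular p 5 (A 5 (+ 1 ∷ + 1 ∷ a₃ ∷ a₄ ∷ a₅ ∷ []))
  superregular[¼,-⅛,¼] {p} pr 7≤p {a₃} {a₄} {a₅} a₃≡¼ a₄≡-⅛ a₅≡¼ =
    ltSuperregular-scaled pr (prime∤30 pr 7≤p) (+ 8) (∣power⇒∤ pr (prime∤30 pr 7≤p) (+ 8) _)
      (A 5 (+ 1 ∷ + 1 ∷ a₃ ∷ a₄ ∷ a₅ ∷ [])) (A 5 (+ 8 ∷ + 8 ∷ + 2 ∷ - + 1 ∷ + 2 ∷ []))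
      (A-scaled (+ 8) 5 (∣ₛ0 p ∷ ∣ₛ0 p ∷ 8a≡2 a₃ a₃≡¼ ∷ 8a≡-1 a₄ a₄≡-⅛ ∷ 8a≡2 a₅ a₅≡¼ ∷ [])) _

  superregular[¾,⅜,¼] : ∀ {p} → Prime p → 7 ≤ p → ∀ {a₃ a₄ a₅} → + p ∣ + 4 * a₃ - + 3 → + p ∣ + 8 * a₄ - + 3 →
    + p ∣ + 4 * a₅ - + 1 → LTSuperregular p 5 (A 5 (+ 1 ∷ + 1 ∷ a₃ ∷ a₄ ∷ a₅ ∷ []))
  superregular[¾,⅜,¼] {p} pr 7≤p {a₃} {a₄} {a₅} a₃≡¾ a₄≡⅜ a₅≡¼ =
    ltSuperregular-scaled pr (prime∤30 pr 7≤p) (+ 8) (∣power⇒∤ pr (prime∤30 pr 7≤p) (+ 8) _)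
      (A 5 (+ 1 ∷ + 1 ∷ a₃ ∷ a₄ ∷ a₅ ∷ [])) (A 5 (+ 8 ∷ + 8 ∷ + 6 ∷ + 3 ∷ + 2 ∷ []))
      (A-scaled (+ 8) 5 (∣ₛ0 p ∷ ∣ₛ0 p ∷ 8a≡6 a₃ a₃≡¾ ∷ Signed.∣ᵤ⇒∣ a₄≡⅜ ∷ 8a≡2 a₅ a₅≡¼ ∷ [])) _

  superregular[½,1,-½] : ∀ {p} → Prime p → 11 ≤ p → ∀ {b₃ b₄ b₅} → + p ∣ + 2 * b₃ - + 1 → + p ∣ b₄ - + 1 →
    + p ∣ + 2 * b₅ + + 1 → LTSuperregular p 5 (A 5 (+ 1 ∷ + 1 ∷ b₃ ∷ b₄ ∷ b₅ ∷ []))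
  superregular[½,1,-½] {p} pr 11≤p {b₃} {b₄} {b₅} b₃≡½ b₄≡1 b₅≡-½ =
    ltSuperregular-scaled pr p∤210 (+ 2) (∣power⇒∤ pr p∤210 (+ 2) _)
      (A 5 (+ 1 ∷ + 1 ∷ b₃ ∷ b₄ ∷ b₅ ∷ [])) (A 5 (+ 2 ∷ + 2 ∷ + 1 ∷ + 2 ∷ - + 1 ∷ []))
      (A-scaled (+ 2) 5 (∣ₛ0 p ∷ ∣ₛ0 p ∷ Signed.∣ᵤ⇒∣ b₃≡½ ∷ 2b≡2 b₄ b₄≡1 ∷ 2b≡-1 b₅ b₅≡-½ ∷ [])) _
    where
    p∤210 : ¬ p ℕ.∣ 210
    p∤210 = prime∤210 pr (ℕₚ.≤-trans (ℕₚ.m≤m+n 8 3) 11≤p)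

mainTheorem2 : (p : ℕ) → Prime p → 7 ≤ p → (a₃ a₄ : ℤ) →
    (((+ p) ∣ (+ 4 * a₃ - + 1) × (+ p) ∣ (+ 8 * a₄ + + 1)) ⊎
     ((+ p) ∣ (+ 4 * a₃ - + 3) × (+ p) ∣ (+ 8 * a₄ - + 3))) →
    (p ≡ 7 → HasSize 6 (InS p 5 (a₃ ∷ a₄ ∷ []))) ×
    (7 < p → HasSize 7 (InS p 5 (a₃ ∷ a₄ ∷ []))) ×
    ((a₅ : ℤ) → (+ p) ∣ (+ 4 * a₅ - + 1) →
      LTSuperregular p 5 (A 5 (+ 1 ∷ + 1 ∷ a₃ ∷ a₄ ∷ a₅ ∷ []))) ×
    (11 ≤ p → (b₃ b₄ b₅ : ℤ) →
      (+ p) ∣ (+ 2 * b₃ - + 1) → (+ p) ∣ (b₄ - + 1) → (+ p) ∣ (+ 2 * b₅ + + 1) →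
      LTSuperregular p 5 (A 5 (+ 1 ∷ + 1 ∷ b₃ ∷ b₄ ∷ b₅ ∷ [])))
mainTheorem2 p pr 7≤p a₃ a₄ (inj₁ (a₃≡¼ , a₄≡-⅛)) =
  let at-7 , above-7 = S-size[¼,-⅛] pr 7≤p a₃≡¼ a₄≡-⅛
  in at-7 , above-7 , (λ _ → superregular[¼,-⅛,¼] pr 7≤p a₃≡¼ a₄≡-⅛) ,
     (λ 11≤p _ _ _ → superregular[½,1,-½] pr 11≤p)
mainTheorem2 p pr 7≤p a₃ a₄ (inj₂ (a₃≡¾ , a₄≡⅜)) =
  let at-7 , above-7 = S-size[¾,⅜] pr 7≤p a₃≡¾ a₄≡⅜
  in at-7 , above-7 , (λ _ → superregular[¾,⅜,¼] pr 7≤p a₃≡¾ a₄≡⅜) ,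
     (λ 11≤p _ _ _ → superregular[½,1,-½] pr 11≤p)
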